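{- Let $U\colon \mathcal{E}\to\mathbf{Set}$ be a topological category and let $\overline T$ be a monad on $\mathcal{E}$ lifting a monad $T$ on $\mathbf{Set}$. Let $a\colon \overline TA\to A$ be a $\overline T$-algebra and let $P$ be an object of $\mathcal{E}$. Then there is at most one $\overline T$-algebra structure $p\colon \overline TP\to P$ such that $(P,p)$ is a refinement of $(A,a)$.
   Context: $U\colon\mathcal{E}\to\mathbf{Set}$ is topological: every $U$-structured source $(B\xrightarrow{f_i}UA_i)_{i\in I}$ has a unique $U$-initial lift. For a set $X$, the fibre $\mathcal{E}_X$ is the thin category of objects $P$ with $UP=X$ and morphisms $h$ with $Uh=\mathit{id}_X$; write $P\sqsubseteq P'$ if such a morphism $P\to P'$ exists. A monad $\overline T$ on $\mathcal{E}$ lifts $T$ if $U\overline T=TU$ and $U$ maps the unit and multiplication of $\overline T$ to those of $T$. A $\overline T$-algebra $(P,p)$ is a refinement of a $\overline T$-algebra $(A,a)$ if $P\in\mathcal{E}_{UA}$, $A\sqsubseteq P$, and the unique morphism $\iota_{A,P}\colon A\to P$ with $U\iota_{A,P}=\mathit{id}_{UA}$ is a $\overline T$-algebra homomorphism. -}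

module Defs where

open import Level using (Level; _⊔_; suc)
open import Data.Product using (Σ; _×_; _,_; proj₁; proj₂)
open import Relation.Binary.Core using (Rel)
open import Relation.Binary.Structures using (IsEquivalence)
open import Relation.Binary.PropositionalEquality using (_≡_; refl; trans; cong)

coe : ∀ {s} {X Y : Set s} → X ≡ Y → X → Y
coe refl x = x

_≐_ : ∀ {s t} {X : Set s} {Y : Set t} → (X → Y) → (X → Y) → Set (s ⊔ t)
f ≐ g = ∀ x → f x ≡ g x
infix 4 _≐_

record Category (o h e : Level) : Set (suc (o ⊔ h ⊔ e)) where
  infixr 9 _∘_
  infix 4 _≈_
  field
    Obj : Set o
    Hom : Obj → Obj → Set h
    _≈_ : ∀ {A B} → Rel (Hom A B) e
    id  : ∀ {A} → Hom A A
    _∘_ : ∀ {A B C} → Hom B C → Hom A B → Hom A C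
    ≈-equiv   : ∀ {A B} → IsEquivalence (_≈_ {A} {B})
    ∘-resp-≈  : ∀ {A B C} {f f' : Hom B C} {g g' : Hom A B} →
                f ≈ f' → g ≈ g' → f ∘ g ≈ f' ∘ g'
    identityˡ : ∀ {A B} {f : Hom A B} → id ∘ f ≈ f
    identityʳ : ∀ {A B} {f : Hom A B} → f ∘ id ≈ f
    assoc     : ∀ {A B C D} {f : Hom A B} {g : Hom B C} {k : Hom C D} →
                (k ∘ g) ∘ f ≈ k ∘ (g ∘ f)

record FunctorToSet {o h e} (𝓔 : Category o h e) (s : Level)
       : Set (o ⊔ h ⊔ e ⊔ suc s) where
  open Category 𝓔
  field
    U₀     : Obj → Set s
    U₁     : ∀ {A B} → Hom A B → U₀ A → U₀ B
    U-resp : ∀ {A B} {f g : Hom A B} → f ≈ g → U₁ f ≐ U₁ g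
    U-id   : ∀ {A} → U₁ (id {A}) ≐ (λ x → x)
    U-∘    : ∀ {A B C} (g : Hom B C) (f : Hom A B) →
             U₁ (g ∘ f) ≐ (λ x → U₁ g (U₁ f x))

module _ {o h e s} {𝓔 : Category o h e} (U : FunctorToSet 𝓔 s) where
  open Category 𝓔
  open FunctorToSet U

  IsInitialSource : ∀ {i} {I : Set i} (A : I → Obj) (C : Obj) →
                    (g : ∀ j → Hom C (A j)) → Set (o ⊔ h ⊔ e ⊔ s ⊔ i)
  IsInitialSource {I = I} A C g =
    ∀ (D : Obj) (k : ∀ j → Hom D (A j)) (φ : U₀ D → U₀ C) →
    (∀ j → U₁ (k j) ≐ (λ x → U₁ (g j) (φ x))) →
    Σ (Hom D C) (λ φ̄ → (U₁ φ̄ ≐ φ) × (∀ j → g j ∘ φ̄ ≈ k j))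
    × (∀ (φ̄ φ̄' : Hom D C) →
         U₁ φ̄ ≐ φ → (∀ j → g j ∘ φ̄ ≈ k j) →
         U₁ φ̄' ≐ φ → (∀ j → g j ∘ φ̄' ≈ k j) → φ̄ ≈ φ̄')

  record InitialLiftAt {i} {I : Set i} (X : Set s) (A : I → Obj)
         (f : ∀ j → X → U₀ (A j)) (C : Obj) : Set (o ⊔ h ⊔ e ⊔ suc s ⊔ i) where
    field
      carrier : U₀ C ≡ X
      arrows  : ∀ j → Hom C (A j)
      over    : ∀ j → U₁ (arrows j) ≐ (λ x → f j (coe carrier x))
      initial : IsInitialSource A C arrows

  record IsTopological (i : Level) : Set (suc (o ⊔ h ⊔ e ⊔ s ⊔ i)) where
    field
      lift         : ∀ {I : Set i} (X : Set s) (A : I → Obj) (f : ∀ j → X → U₀ (A j)) →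
                     Σ Obj (InitialLiftAt X A f)
      lift-unique-obj : ∀ {I : Set i} (X : Set s) (A : I → Obj) (f : ∀ j → X → U₀ (A j))
                        {C C' : Obj} → InitialLiftAt X A f C → InitialLiftAt X A f C' →
                        C ≡ C'
      lift-unique-arr : ∀ {I : Set i} (X : Set s) (A : I → Obj) (f : ∀ j → X → U₀ (A j))
                        {C : Obj} (L L' : InitialLiftAt X A f C) →
                        ∀ j → InitialLiftAt.arrows L j ≈ InitialLiftAt.arrows L' j

record SetMonad (s : Level) : Set (suc s) where
  field
    T₀     : Set s → Set s
    T₁     : ∀ {X Y : Set s} → (X → Y) → T₀ X → T₀ Y
    T-resp : ∀ {X Y : Set s} {f g : X → Y} → f ≐ g → T₁ f ≐ T₁ g
    T-id   : ∀ {X : Set s} → T₁ (λ (x : X) → x) ≐ (λ x → x)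
    T-∘    : ∀ {X Y Z : Set s} (g : Y → Z) (f : X → Y) →
             T₁ (λ x → g (f x)) ≐ (λ t → T₁ g (T₁ f t))
    η      : ∀ {X : Set s} → X → T₀ X
    μ      : ∀ {X : Set s} → T₀ (T₀ X) → T₀ X
    η-nat  : ∀ {X Y : Set s} (f : X → Y) → (λ x → T₁ f (η x)) ≐ (λ x → η (f x))
    μ-nat  : ∀ {X Y : Set s} (f : X → Y) → (λ t → T₁ f (μ t)) ≐ (λ t → μ (T₁ (T₁ f) t))
    μ-η    : ∀ {X : Set s} → (λ (t : T₀ X) → μ (η t)) ≐ (λ t → t)
    μ-Tη   : ∀ {X : Set s} → (λ (t : T₀ X) → μ (T₁ η t)) ≐ (λ t → t)
    μ-assoc : ∀ {X : Set s} → (λ (t : T₀ (T₀ (T₀ X))) → μ (T₁ μ t)) ≐ (λ t → μ (μ t))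

record Monad {o h e} (𝓔 : Category o h e) : Set (o ⊔ h ⊔ e) where
  open Category 𝓔
  field
    F₀     : Obj → Obj
    F₁     : ∀ {A B} → Hom A B → Hom (F₀ A) (F₀ B)
    F-resp : ∀ {A B} {f g : Hom A B} → f ≈ g → F₁ f ≈ F₁ g
    F-id   : ∀ {A} → F₁ (id {A}) ≈ id
    F-∘    : ∀ {A B C} (g : Hom B C) (f : Hom A B) → F₁ (g ∘ f) ≈ F₁ g ∘ F₁ f
    η̄      : ∀ A → Hom A (F₀ A)
    μ̄      : ∀ A → Hom (F₀ (F₀ A)) (F₀ A)
    η̄-nat  : ∀ {A B} (f : Hom A B) → F₁ f ∘ η̄ A ≈ η̄ B ∘ f
    μ̄-nat  : ∀ {A B} (f : Hom A B) → F₁ f ∘ μ̄ A ≈ μ̄ B ∘ F₁ (F₁ f)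
    μ̄-η̄    : ∀ A → μ̄ A ∘ η̄ (F₀ A) ≈ id
    μ̄-Fη̄   : ∀ A → μ̄ A ∘ F₁ (η̄ A) ≈ id
    μ̄-assoc : ∀ A → μ̄ A ∘ F₁ (μ̄ A) ≈ μ̄ A ∘ μ̄ (F₀ A)

record IsLifting {o h e s} {𝓔 : Category o h e} (U : FunctorToSet 𝓔 s)
       (T : SetMonad s) (T̄ : Monad 𝓔) : Set (o ⊔ h ⊔ suc s) where
  open Category 𝓔
  open FunctorToSet U
  open SetMonad T
  open Monad T̄
  field
    obj  : ∀ A → U₀ (F₀ A) ≡ T₀ (U₀ A)
  obj² : ∀ A → U₀ (F₀ (F₀ A)) ≡ T₀ (T₀ (U₀ A))
  obj² A = trans (obj (F₀ A)) (cong T₀ (obj A))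
  field
    mor  : ∀ {A B} (f : Hom A B) →
           (λ z → coe (obj B) (U₁ (F₁ f) z)) ≐ (λ z → T₁ (U₁ f) (coe (obj A) z))
    unit : ∀ A → (λ x → coe (obj A) (U₁ (η̄ A) x)) ≐ (λ x → η x)
    mult : ∀ A → (λ z → coe (obj A) (U₁ (μ̄ A) z)) ≐ (λ z → μ (coe (obj² A) z))

module _ {o h e} {𝓔 : Category o h e} (T̄ : Monad 𝓔) where
  open Category 𝓔
  open Monad T̄

  record IsAlgebra (A : Obj) (a : Hom (F₀ A) A) : Set e where
    field
      alg-unit  : a ∘ η̄ A ≈ id
      alg-assoc : a ∘ F₁ a ≈ a ∘ μ̄ A

  module _ {s} (U : FunctorToSet 𝓔 s) where
    open FunctorToSet U

    -- (P , p) is a refinement of (A , a), where P lies in the fibre over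
    -- U A via the given identification UP = UA (written as UA ≡ UP):
    -- A ⊑ P, and the (unique) morphism ι : A → P with U ι = id is a
    -- T̄-algebra homomorphism.
    Refinement : (A : Obj) (a : Hom (F₀ A) A) (P : Obj) (p : Hom (F₀ P) P) →
                 U₀ A ≡ U₀ P → Set (h ⊔ e ⊔ s)
    Refinement A a P p eq =
      Σ (Hom A P) (λ ι → U₁ ι ≐ coe eq)
      × (∀ (ι : Hom A P) → U₁ ι ≐ coe eq → ι ∘ a ≈ p ∘ F₁ ι)

{-# OPTIONS --safe #-}
module Submission where

-- Topological functors are faithful, and ι : A → P has the identity of U A
-- as underlying map, so U (T̄ ι) = T (U ι) is a split epimorphism and T̄ ι is
-- an epimorphism of 𝓔.  Both p and p' make ι a homomorphism, so
-- p ∘ T̄ ι ≈ ι ∘ a ≈ p' ∘ T̄ ι, and cancelling T̄ ι gives p ≈ p'.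

open import Defs
open import Level using (Level; 0ℓ; _⊔_)
open import Relation.Binary.Bundles using (Setoid)
open import Relation.Binary.PropositionalEquality
  using (_≡_; refl; sym; trans; cong; module ≡-Reasoning)
open import Relation.Binary.Structures using (IsEquivalence)
open import Data.Bool using (Bool; true; false; not)
open import Data.Product using (Σ; _,_; proj₁; proj₂)

coe-coe-sym : ∀ {s} {X Y : Set s} (q : X ≡ Y) (y : Y) → coe q (coe (sym q) y) ≡ y
coe-coe-sym refl y = refl

coe-injective : ∀ {s} {X Y : Set s} (q : X ≡ Y) {x x' : X} → coe q x ≡ coe q x' → x ≡ x'
coe-injective refl x≡x' = x≡x'

IsSection : ∀ {s t} {X : Set s} {Y : Set t} → (X → Y) → (Y → X) → Set t
IsSection f σ = (λ y → f (σ y)) ≐ (λ y → y)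

SplitEpi : ∀ {s t} {X : Set s} {Y : Set t} → (X → Y) → Set (s ⊔ t)
SplitEpi f = Σ _ (IsSection f)

T₁-section : ∀ {s} (T : SetMonad s) {X Y : Set s} {f : X → Y} {σ : Y → X} →
             IsSection f σ → IsSection (SetMonad.T₁ T f) (SetMonad.T₁ T σ)
T₁-section T {f = f} {σ} fσ≐id t = begin
  T₁ f (T₁ σ t)         ≡⟨ T-∘ f σ t ⟨
  T₁ (λ y → f (σ y)) t  ≡⟨ T-resp fσ≐id t ⟩
  T₁ (λ y → y) t        ≡⟨ T-id t ⟩
  t                     ∎
  where open SetMonad T
        open ≡-Reasoning

module _ {o h e s} {𝓔 : Category o h e} (U : FunctorToSet 𝓔 s) where
  open Category 𝓔
  open FunctorToSet U
  private module ≈ {A B} = IsEquivalence (≈-equiv {A} {B})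

  hom-setoid : Obj → Obj → Setoid h e
  hom-setoid A B = record { isEquivalence = ≈-equiv {A} {B} }

  IsFaithful : Set (o ⊔ h ⊔ e ⊔ s)
  IsFaithful = ∀ {D C} {f g : Hom D C} → U₁ f ≐ U₁ g → f ≈ g

  swap-initial : ∀ {A : Bool → Obj} {C : Obj} (g : ∀ j → Hom C (A j)) →
                 IsInitialSource U A C g →
                 IsInitialSource U (λ j → A (not j)) C (λ j → g (not j))
  swap-initial g initial D k φ k-over = factorisation , unique
    where
      swapped = initial D (λ { true → k false ; false → k true }) φ
                          (λ { true → k-over false ; false → k-over true })
      factorisation = let φ̄ , φ̄-over , φ̄-factors = proj₁ swapped in
             φ̄ , φ̄-over , λ { true → φ̄-factors false ; false → φ̄-factors true }
      unique = λ φ̄ φ̄' u c u' c' →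
        proj₂ swapped φ̄ φ̄' u  (λ { true → c false  ; false → c true })
                            u' (λ { true → c' false ; false → c' true })

  -- Lift the source (id , id) : U C → (U C , U C).  Its lift and the lift with
  -- the two arrows swapped must agree, so both arrows are the same morphism c;
  -- f and g both factor through c via the same morphism, since U f = U g.
  topological⇒faithful : IsTopological U 0ℓ → IsFaithful
  topological⇒faithful top {D} {C} {f} {g} Uf≐Ug =
    begin
      f            ≈⟨ factors true ⟨
      c true  ∘ φ̄  ≈⟨ ∘-resp-≈ c-true≈c-false ≈.refl ⟩
      c false ∘ φ̄  ≈⟨ factors false ⟩
      g            ∎
    where
      open IsTopological top
      open import Relation.Binary.Reasoning.Setoid (hom-setoid D C)

      diagonal : Bool → U₀ C → U₀ C
      diagonal _ x = x

      Cₗ : Obj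
      Cₗ = proj₁ (lift (U₀ C) (λ _ → C) diagonal)

      L : InitialLiftAt U (U₀ C) (λ _ → C) diagonal Cₗ
      L = proj₂ (lift (U₀ C) (λ _ → C) diagonal)
      open InitialLiftAt L renaming (arrows to c)

      L-swapped : InitialLiftAt U (U₀ C) (λ _ → C) diagonal Cₗ
      L-swapped = record { carrier = carrier ; arrows = λ j → c (not j)
                         ; over = λ j → over (not j) ; initial = swap-initial c initial }

      c-true≈c-false : c true ≈ c false
      c-true≈c-false = lift-unique-arr (U₀ C) (λ _ → C) diagonal L L-swapped true

      φ : U₀ D → U₀ Cₗ
      φ x = coe (sym carrier) (U₁ f x)

      f-and-g : Bool → Hom D C
      f-and-g true  = f
      f-and-g false = g

      U-f-and-g : ∀ j → U₁ (f-and-g j) ≐ U₁ f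
      U-f-and-g true  _ = refl
      U-f-and-g false x = sym (Uf≐Ug x)

      f-and-g-over : ∀ j → U₁ (f-and-g j) ≐ (λ x → U₁ (c j) (φ x))
      f-and-g-over j x =
        trans (U-f-and-g j x) (trans (sym (coe-coe-sym carrier (U₁ f x))) (sym (over j (φ x))))

      φ̄ : Hom D Cₗ
      φ̄ = proj₁ (proj₁ (initial D f-and-g φ f-and-g-over))

      factors : ∀ j → c j ∘ φ̄ ≈ f-and-g j
      factors = proj₂ (proj₂ (proj₁ (initial D f-and-g φ f-and-g-over)))

  faithful⇒split-epi-cancelʳ : IsFaithful → ∀ {A B C} {e : Hom A B} → SplitEpi (U₁ e) →
                               {f g : Hom B C} → f ∘ e ≈ g ∘ e → f ≈ g
  faithful⇒split-epi-cancelʳ faithful {e = e} (τ , eτ≐id) {f} {g} fe≈ge = faithful λ z → begin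
    U₁ f z              ≡⟨ cong (U₁ f) (eτ≐id z) ⟨
    U₁ f (U₁ e (τ z))   ≡⟨ U-∘ f e (τ z) ⟨
    U₁ (f ∘ e) (τ z)    ≡⟨ U-resp fe≈ge (τ z) ⟩
    U₁ (g ∘ e) (τ z)    ≡⟨ U-∘ g e (τ z) ⟩
    U₁ g (U₁ e (τ z))   ≡⟨ cong (U₁ g) (eτ≐id z) ⟩
    U₁ g z              ∎
    where open ≡-Reasoning

  module _ {T : SetMonad s} {T̄ : Monad 𝓔} (lifting : IsLifting U T T̄) where
    open SetMonad T
    open Monad T̄
    open IsLifting lifting

    F₁-preserves-split-epi : ∀ {A B} {e : Hom A B} → SplitEpi (U₁ e) → SplitEpi (U₁ (F₁ e))
    F₁-preserves-split-epi {A} {B} {e} (σ , eσ≐id) = τ , λ z → coe-injective (obj B) (begin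
      coe (obj B) (U₁ (F₁ e) (τ z))                    ≡⟨ mor e (τ z) ⟩
      T₁ (U₁ e) (coe (obj A) (τ z))                    ≡⟨ cong (T₁ (U₁ e)) (coe-coe-sym (obj A) _) ⟩
      T₁ (U₁ e) (T₁ σ (coe (obj B) z))                 ≡⟨ T₁-section T eσ≐id (coe (obj B) z) ⟩
      coe (obj B) z                                    ∎)
      where
        open ≡-Reasoning

        τ : U₀ (F₀ B) → U₀ (F₀ A)
        τ z = coe (sym (obj A)) (T₁ σ (coe (obj B) z))

lemma3p2 : ∀ {o h e s : Level} (𝓔 : Category o h e) (U : FunctorToSet 𝓔 s)
    → (∀ {i : Level} → IsTopological U i)
    → (T : SetMonad s) (T̄ : Monad 𝓔) → IsLifting U T T̄
    → (A : Category.Obj 𝓔) (a : Category.Hom 𝓔 (Monad.F₀ T̄ A) A) → IsAlgebra T̄ A a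
    → (P : Category.Obj 𝓔) (eq : FunctorToSet.U₀ U A ≡ FunctorToSet.U₀ U P)
    → (p p' : Category.Hom 𝓔 (Monad.F₀ T̄ P) P)
    → IsAlgebra T̄ P p → Refinement T̄ U A a P p eq
    → IsAlgebra T̄ P p' → Refinement T̄ U A a P p' eq
    → Category._≈_ 𝓔 p p'
lemma3p2 𝓔 U top T T̄ lifting A a _ P eq p p' _ ((ι , Uι≐coe) , ι-hom) _ (_ , ι-hom') =
  faithful⇒split-epi-cancelʳ U (topological⇒faithful U top)
    (F₁-preserves-split-epi U lifting Uι-split-epi) p∘F₁ι≈p'∘F₁ι
  where
    open Category 𝓔
    open Monad T̄ using (F₁)
    module ≈ {X Y} = IsEquivalence (≈-equiv {X} {Y})

    Uι-split-epi : SplitEpi (FunctorToSet.U₁ U ι)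
    Uι-split-epi = coe (sym eq) , λ y → trans (Uι≐coe _) (coe-coe-sym eq y)

    p∘F₁ι≈p'∘F₁ι : p ∘ F₁ ι ≈ p' ∘ F₁ ι
    p∘F₁ι≈p'∘F₁ι = ≈.trans (≈.sym (ι-hom ι Uι≐coe)) (ι-hom' ι Uι≐coe)
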